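{- Let $k,\ell\in\mathbb{N}$. Then $|\mathcal{J}(k,\ell)_n|=O(n^{k-1}F_{n,\ell})$ as $n\to\infty$, where $\mathcal{J}(k,\ell)_n$ is the set of ordered graphs in $\mathcal{J}(k,\ell)$ with vertex set $[n]$.
   Context: An ordered graph of order $n$ is a graph on vertex set $[n]$ with the natural order; $A\leqslant B$ means $A$ is an induced ordered subgraph of $B$. For ordered graphs $G_1,\dots,G_m$ of orders $n_1,\dots,n_m$ with $N_i=n_1+\cdots+n_i$, $G_1+\cdots+G_m$ has vertex set $[N_m]$ with a copy of $G_i$ on $[N_{i-1}+1,N_i]$ and no edges between different intervals. For $n\in\mathbb{N}$: $J^{(n)}_1=K_n$; $J^{(n)}_2$ on $[n]$ has edge set $\{1n\}$ (empty if $n=1$); $J^{(n)}_3$ has edge set $\{1i:i\in[2,n]\}$; $J^{(n)}_4$ has edge set $\{in:i\in[n-1]\}$; $L^{(n)}$ has edge set $\{i(i+1):i\in[n-1]\}$; $Q_1$ on $[4]$ has edges $\{13,24\}$; $Q_2$ on $[4]$ has edges $\{14,23\}$. $\mathcal{J}_\ell=\{J^{(n)}_i:i\in[4],n\leqslant\ell\}\cup\{L^{(n)}:n\leqslant\ell\}$ for $\ell\le3$, additionally including $Q_1,Q_2$ for $\ell\geqslant4$. $G\in\mathcal{J}(k,\ell)$ iff there are $s\leqslant k$ ordered graphs $A_1,\dots,A_s$ with $G=A_1+\cdots+A_s$ such that each $A_i=B^{(i)}_1+\cdots+B^{(i)}_{t(i)}$ with every $B^{(i)}_j\in\mathcal{J}_\ell$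 and, for all $j,j'$, $B^{(i)}_j\leqslant B^{(i)}_{j'}$ or $B^{(i)}_{j'}\leqslant B^{(i)}_j$. $F_{n,\ell}=0$ for $n<0$, $F_{0,\ell}=1$, $F_{n,\ell}=F_{n-1,\ell}+\cdots+F_{n-\ell,\ell}$ for $n\ge1$. -}

module Defs where

open import Data.Nat using (ℕ; zero; suc; _+_; _*_; _∸_; _^_; _≤_; _≡ᵇ_)
open import Data.Bool using (Bool; true; false; _∧_; _∨_; not; _xor_)
open import Data.Fin as Fin using (Fin; toℕ; splitAt)
open import Data.Vec using (Vec; []; tabulate; lookup)
open import Data.List as List using (List; []; _∷_; foldr; take)
open import Data.List.Membership.Propositional using (_∈_)
open import Data.Nat.ListAction using (sum)
open import Data.Product using (Σ; _×_; _,_)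
open import Data.Sum using (_⊎_; inj₁; inj₂)
open import Relation.Binary.PropositionalEquality using (_≡_)

-- An ordered graph of order n: adjacency matrix on vertex set {0,…,n-1}
-- (0-based rendering of [n] with its natural order).
Graph : ℕ → Set
Graph n = Vec (Vec Bool n) n

adj : ∀ {n} → Graph n → Fin n → Fin n → Bool
adj G i j = lookup (lookup G i) j

OGraph : Set
OGraph = Σ ℕ Graph

mkGraph : (n : ℕ) → (ℕ → ℕ → Bool) → Graph n
mkGraph n f = tabulate (λ i → tabulate (λ j → f (toℕ i) (toℕ j)))

_⊑_ : OGraph → OGraph → Set
(a , A) ⊑ (b , B) =
  Σ (Fin a → Fin b) λ f →
    (∀ i j → i Fin.< j → f i Fin.< f j) ×
    (∀ i j → adj A i j ≡ adj B (f i) (f j))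

sumAdj : ∀ {m n} → Graph m → Graph n → Fin (m + n) → Fin (m + n) → Bool
sumAdj {m} G H i j with splitAt m i | splitAt m j
... | inj₁ a | inj₁ b = adj G a b
... | inj₂ a | inj₂ b = adj H a b
... | inj₁ _ | inj₂ _ = false
... | inj₂ _ | inj₁ _ = false

_⊕_ : OGraph → OGraph → OGraph
(m , G) ⊕ (n , H) = (m + n , tabulate (λ i → tabulate (λ j → sumAdj G H i j)))

⨁ : List OGraph → OGraph
⨁ = foldr _⊕_ (0 , [])

-- the basic graphs (vertices 0-based: paper vertex i is index i-1)
J1 : (n : ℕ) → Graph n
J1 n = mkGraph n (λ i j → not (i ≡ᵇ j))

J2 : (n : ℕ) → Graph n
J2 n = mkGraph n (λ i j → not (i ≡ᵇ j) ∧
         (((i ≡ᵇ 0) ∧ (j ≡ᵇ (n ∸ 1))) ∨ ((j ≡ᵇ 0) ∧ (i ≡ᵇ (n ∸ 1)))))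

J3 : (n : ℕ) → Graph n            -- edge set {1i : i ∈ [2,n]}
J3 n = mkGraph n (λ i j → (i ≡ᵇ 0) xor (j ≡ᵇ 0))

J4 : (n : ℕ) → Graph n            -- edge set {in : i ∈ [n-1]}
J4 n = mkGraph n (λ i j → (i ≡ᵇ (n ∸ 1)) xor (j ≡ᵇ (n ∸ 1)))

L : (n : ℕ) → Graph n
L n = mkGraph n (λ i j → (suc i ≡ᵇ j) ∨ (suc j ≡ᵇ i))

Q1 : Graph 4
Q1 = mkGraph 4 (λ i j → ((i ≡ᵇ 0) ∧ (j ≡ᵇ 2)) ∨ ((i ≡ᵇ 2) ∧ (j ≡ᵇ 0))
                      ∨ ((i ≡ᵇ 1) ∧ (j ≡ᵇ 3)) ∨ ((i ≡ᵇ 3) ∧ (j ≡ᵇ 1)))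

Q2 : Graph 4
Q2 = mkGraph 4 (λ i j → ((i ≡ᵇ 0) ∧ (j ≡ᵇ 3)) ∨ ((i ≡ᵇ 3) ∧ (j ≡ᵇ 0))
                      ∨ ((i ≡ᵇ 1) ∧ (j ≡ᵇ 2)) ∨ ((i ≡ᵇ 2) ∧ (j ≡ᵇ 1)))

data InJℓ (ℓ : ℕ) : OGraph → Set where
  j1 : ∀ {n} → 1 ≤ n → n ≤ ℓ → InJℓ ℓ (n , J1 n)
  j2 : ∀ {n} → 1 ≤ n → n ≤ ℓ → InJℓ ℓ (n , J2 n)
  j3 : ∀ {n} → 1 ≤ n → n ≤ ℓ → InJℓ ℓ (n , J3 n)
  j4 : ∀ {n} → 1 ≤ n → n ≤ ℓ → InJℓ ℓ (n , J4 n)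
  jL : ∀ {n} → 1 ≤ n → n ≤ ℓ → InJℓ ℓ (n , L n)
  q1 : 4 ≤ ℓ → InJℓ ℓ (4 , Q1)
  q2 : 4 ≤ ℓ → InJℓ ℓ (4 , Q2)

ValidBlock : ℕ → List OGraph → Set
ValidBlock ℓ Bs =
  (∀ {B} → B ∈ Bs → InJℓ ℓ B) ×
  (∀ {B B′} → B ∈ Bs → B′ ∈ Bs → (B ⊑ B′) ⊎ (B′ ⊑ B))

InJ : ℕ → ℕ → OGraph → Set
InJ k ℓ G =
  Σ (List (List OGraph)) λ Bss →
    (List.length Bss ≤ k) ×
    (∀ {Bs} → Bs ∈ Bss → ValidBlock ℓ Bs) ×
    (⨁ (List.map ⨁ Bss) ≡ G)

-- F_{n,ℓ}: Fvals n = [F_n, F_{n-1}, …, F_0]; terms with negative index are 0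
Fvals : ℕ → ℕ → List ℕ
Fvals ℓ zero    = 1 ∷ []
Fvals ℓ (suc n) = sum (take ℓ (Fvals ℓ n)) ∷ Fvals ℓ n

F : ℕ → ℕ → ℕ
F n ℓ with Fvals ℓ n
... | []    = 0
... | x ∷ _ = x

-- Two basic graphs of one block having the same order are comparable, hence
-- equal (a strictly increasing self-map of [m] is the identity), so a block is determined by the orders of its pieces together with a profile assigning
-- one of seven shapes to each order in [0, ℓ].  Hence a graph is encoded by the sequence of piece
-- orders, a composition of n with parts in [1, ℓ], of which there are F n ℓ; by the profiles of
-- the at most k blocks; and by the number of pieces in each block but the last, at most n each.
-- This gives at most c(ℓ, k) · n^(k-1) · F n ℓ graphs.
module Submission where

open import Defs
open import Data.Nat using (ℕ; _*_; _^_; _≤_)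
open import Data.Product using (Σ; _,_)
open import Data.List using (List; length)
open import Data.List.Relation.Unary.All using (All)
open import Data.List.Relation.Unary.Unique.Propositional using (Unique)

import Data.Bool.Properties as Bool
open import Data.Fin.Base as Fin using (Fin; toℕ; inject₁; opposite)
open import Data.Fin.Properties
  using (toℕ-injective; toℕ<n; toℕ-inject₁; opposite-prop; opposite-involutive; injective⇒≤)
open import Data.List.Base
  using ([]; _∷_; _++_; map; take; drop; concatMap; applyUpTo; upTo;
         cartesianProduct; cartesianProductWith)
import Data.List.Base as List
open import Data.List.Properties
  using (length-++; length-map; length-applyUpTo; length-upTo; take-map; map-∘; map-id-local;
         ++-identityʳ)
open import Data.List.Membership.Propositional using (_∈_; find; lose)
open import Data.List.Membership.Propositional.Properties
  using (∈-++⁺ˡ; ∈-++⁺ʳ; ∈-map⁺; ∈-map⁻; ∈-lookup; ∈-cartesianProductWith⁺; ∈-cartesianProduct⁺;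
         ∈-upTo⁺)
open import Data.List.Relation.Binary.Subset.Propositional using (_⊆_)
open import Data.List.Relation.Unary.All using ([]; _∷_)
open import Data.List.Relation.Unary.AllPairs using (_∷_)
import Data.List.Relation.Unary.All as All
import Data.List.Relation.Unary.All.Properties as Allₚ
open import Data.List.Relation.Unary.Any using (here; there; any?)
import Data.List.Relation.Unary.Any as Any
open import Data.List.Relation.Unary.Any.Properties using (lookup-index)
import Data.List.Relation.Unary.Unique.Propositional.Properties as Unique
open import Data.Nat.Base using (zero; suc; _+_; _<_; z≤n; s≤s; s≤s⁻¹)
open import Data.Nat.Properties
open import Data.Nat.ListAction using (sum)
open import Data.Nat.ListAction.Properties using (sum-++)
open import Data.Nat.Tactic.RingSolver using (solve-∀)
open import Data.Product.Base using (∃; _×_; proj₁; proj₂)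
import Data.Product.Properties as Product
open import Data.Sum.Base using (_⊎_; inj₁; inj₂)
import Data.Vec.Base as Vec
import Data.Vec.Properties as Vecₚ
open import Function.Base using (_∘_)
open import Relation.Binary.Definitions using (DecidableEquality)
open import Relation.Binary.PropositionalEquality
open import Relation.Nullary using (yes; no; contradiction)

module _ {A : Set} where

  Unique-lookup-injective : ∀ {xs : List A} → Unique xs →
                            ∀ {i j} → List.lookup xs i ≡ List.lookup xs j → i ≡ j
  Unique-lookup-injective (_ ∷ _)     {Fin.zero}  {Fin.zero}  _  = refl
  Unique-lookup-injective (x∉xs ∷ _) {Fin.zero}  {Fin.suc j} eq =
    contradiction eq (All.lookup x∉xs (∈-lookup j))
  Unique-lookup-injective (x∉xs ∷ _) {Fin.suc i} {Fin.zero}  eq =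
    contradiction (sym eq) (All.lookup x∉xs (∈-lookup i))
  Unique-lookup-injective (_ ∷ u)     {Fin.suc i} {Fin.suc j} eq =
    cong Fin.suc (Unique-lookup-injective u eq)

  Unique⇒length≤ : ∀ {xs ys : List A} → Unique xs → xs ⊆ ys → length xs ≤ length ys
  Unique⇒length≤ {xs} {ys} u xs⊆ys = injective⇒≤ position-injective
    where
    position : Fin (length xs) → Fin (length ys)
    position i = Any.index (xs⊆ys (∈-lookup i))

    position-injective : ∀ {i j} → position i ≡ position j → i ≡ j
    position-injective {i} {j} eq = Unique-lookup-injective u (begin
      List.lookup xs i            ≡⟨ lookup-index (xs⊆ys (∈-lookup i)) ⟩
      List.lookup ys (position i) ≡⟨ cong (List.lookup ys) eq ⟩
      List.lookup ys (position j) ≡⟨ lookup-index (xs⊆ys (∈-lookup j)) ⟨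
      List.lookup xs j            ∎)
      where open ≡-Reasoning

  length-cartesianProductWith : ∀ {B C : Set} (f : A → B → C) xs ys →
    length (cartesianProductWith f xs ys) ≡ length xs * length ys
  length-cartesianProductWith f []       ys = refl
  length-cartesianProductWith f (x ∷ xs) ys = begin
    length (map (f x) ys ++ cartesianProductWith f xs ys)  ≡⟨ length-++ (map (f x) ys) ⟩
    length (map (f x) ys) + length (cartesianProductWith f xs ys)
      ≡⟨ cong₂ _+_ (length-map (f x) ys) (length-cartesianProductWith f xs ys) ⟩
    length ys + length xs * length ys                      ∎
    where open ≡-Reasoning

  lists≤ : List A → ℕ → List (List A)
  lists≤ as zero    = [] ∷ []
  lists≤ as (suc j) = [] ∷ cartesianProductWith _∷_ as (lists≤ as j)

  ∈-lists≤ : ∀ {as xs j} → All (_∈ as) xs → length xs ≤ j → xs ∈ lists≤ as j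
  ∈-lists≤ {j = zero}  []       _         = here refl
  ∈-lists≤ {j = suc j} []       _         = here refl
  ∈-lists≤ {j = suc j} (x∈ ∷ xs∈) (s≤s len) =
    there (∈-cartesianProductWith⁺ _∷_ x∈ (∈-lists≤ xs∈ len))

  length-lists≤ : ∀ as j → length (lists≤ as j) ≤ suc (length as) ^ j
  length-lists≤ as zero    = ≤-refl
  length-lists≤ as (suc j) =
    subst (_≤ suc (length as) ^ suc j) (cong suc (sym (length-cartesianProductWith _∷_ as _)))
      (+-mono-≤ (m^n>0 (suc (length as)) j) (*-monoʳ-≤ (length as) (length-lists≤ as j)))

length≤sum : ∀ {xs} → All (1 ≤_) xs → length xs ≤ sum xs
length≤sum []         = z≤n
length≤sum (1≤x ∷ ps) = +-mono-≤ 1≤x (length≤sum ps)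

^-distrib-* : ∀ a b j → (a * b) ^ j ≡ a ^ j * b ^ j
^-distrib-* a b zero    = refl
^-distrib-* a b (suc j) = begin
  a * b * (a * b) ^ j       ≡⟨ cong (a * b *_) (^-distrib-* a b j) ⟩
  a * b * (a ^ j * b ^ j)   ≡⟨ rearrange a b (a ^ j) (b ^ j) ⟩
  a * a ^ j * (b * b ^ j)   ∎
  where
  open ≡-Reasoning
  rearrange : ∀ a b x y → a * b * (x * y) ≡ a * x * (b * y)
  rearrange = solve-∀

StrictlyIncreasing : ∀ {m n} → (Fin m → Fin n) → Set
StrictlyIncreasing f = ∀ i j → i Fin.< j → f i Fin.< f j

strictlyIncreasing-inflationary : ∀ {m n} {f : Fin m → Fin n} → StrictlyIncreasing f →
                                  ∀ i → toℕ i ≤ toℕ (f i)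
strictlyIncreasing-inflationary         inc Fin.zero    = z≤n
strictlyIncreasing-inflationary {f = f} inc (Fin.suc i) = begin-strict
  toℕ i                  ≤⟨ strictlyIncreasing-inflationary inc∘inject₁ i ⟩
  toℕ (f (inject₁ i))    <⟨ inc (inject₁ i) (Fin.suc i) (s≤s (≤-reflexive (toℕ-inject₁ i))) ⟩
  toℕ (f (Fin.suc i))    ∎
  where
  open ≤-Reasoning
  inc∘inject₁ : StrictlyIncreasing (f ∘ inject₁)
  inc∘inject₁ i j i<j =
    inc (inject₁ i) (inject₁ j) (subst₂ _<_ (sym (toℕ-inject₁ i)) (sym (toℕ-inject₁ j)) i<j)

opposite-reverses-< : ∀ {n} {i j : Fin n} → i Fin.< j → opposite j Fin.< opposite i
opposite-reverses-< {n} {i} {j} i<j =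
  subst₂ _<_ (sym (opposite-prop j)) (sym (opposite-prop i)) (∸-monoʳ-< (s≤s i<j) (toℕ<n j))

strictlyIncreasing-endo-id : ∀ {n} {f : Fin n → Fin n} → StrictlyIncreasing f → ∀ i → f i ≡ i
strictlyIncreasing-endo-id {n} {f} inc i =
  toℕ-injective (≤-antisym deflationary (strictlyIncreasing-inflationary inc i))
  where
  inc-conjugate : StrictlyIncreasing (opposite ∘ f ∘ opposite)
  inc-conjugate i j = opposite-reverses-< ∘ inc (opposite j) (opposite i) ∘ opposite-reverses-<

  deflationary : toℕ (f i) ≤ toℕ i
  deflationary = s≤s⁻¹ (∸-cancelʳ-≤ (toℕ<n (f i)) (subst₂ _≤_
    (opposite-prop i)
    (trans (cong (toℕ ∘ opposite ∘ f) (opposite-involutive i)) (opposite-prop (f i)))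
    (strictlyIncreasing-inflationary inc-conjugate (opposite i))))

Graph-ext : ∀ {n} {A B : Graph n} → (∀ i j → adj A i j ≡ adj B i j) → A ≡ B
Graph-ext {A = A} {B} eq = begin
  A                                                         ≡⟨ Vecₚ.tabulate∘lookup A ⟨
  Vec.tabulate (Vec.lookup A)                               ≡⟨ Vecₚ.tabulate-cong row-eq ⟩
  Vec.tabulate (Vec.lookup B)                               ≡⟨ Vecₚ.tabulate∘lookup B ⟩
  B                                                         ∎
  where
  open ≡-Reasoning
  row-eq : ∀ i → Vec.lookup A i ≡ Vec.lookup B i
  row-eq i = trans (sym (Vecₚ.tabulate∘lookup (Vec.lookup A i)))
    (trans (Vecₚ.tabulate-cong (eq i)) (Vecₚ.tabulate∘lookup (Vec.lookup B i)))

⊑-sameOrder⇒≡ : ∀ {m} {A B : Graph m} → (m , A) ⊑ (m , B) → A ≡ B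
⊑-sameOrder⇒≡ {B = B} (f , inc , preserves) = Graph-ext λ i j →
  trans (preserves i j)
    (cong₂ (adj B) (strictlyIncreasing-endo-id inc i) (strictlyIncreasing-endo-id inc j))

comparable-sameOrder⇒≡ : ∀ {m} {A B : Graph m} →
                         ((m , A) ⊑ (m , B)) ⊎ ((m , B) ⊑ (m , A)) → A ≡ B
comparable-sameOrder⇒≡ (inj₁ A⊑B) = ⊑-sameOrder⇒≡ A⊑B
comparable-sameOrder⇒≡ (inj₂ B⊑A) = sym (⊑-sameOrder⇒≡ B⊑A)

order-⨁ : ∀ Gs → proj₁ (⨁ Gs) ≡ sum (map proj₁ Gs)
order-⨁ []       = refl
order-⨁ (G ∷ Gs) = cong (proj₁ G +_) (order-⨁ Gs)

InJ-zero⇒order≡0 : ∀ {ℓ n G} → InJ 0 ℓ (n , G) → n ≡ 0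
InJ-zero⇒order≡0 ([] , _ , _ , eq) = sym (cong proj₁ eq)

module Compositions (ℓ : ℕ) where

  Part : ℕ → Set
  Part x = 1 ≤ x × x ≤ ℓ

  -- The i-th list of the argument (counted from 0) receives the new first part j + i + 1.
  prefixParts : ℕ → List (List (List ℕ)) → List (List ℕ)
  prefixParts j []           = []
  prefixParts j (xss ∷ xsss) = map (suc j ∷_) xss ++ prefixParts (suc j) xsss

  compositions : ℕ → List (List ℕ)
  compositionsBelow : ℕ → List (List (List ℕ))

  compositions zero    = [] ∷ []
  compositions (suc n) = prefixParts 0 (take ℓ (compositions n ∷ compositionsBelow n))

  compositionsBelow zero    = []
  compositionsBelow (suc n) = compositions n ∷ compositionsBelow n

  length-prefixParts : ∀ j xsss → length (prefixParts j xsss) ≡ sum (map length xsss)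
  length-prefixParts j []           = refl
  length-prefixParts j (xss ∷ xsss) = trans (length-++ (map (suc j ∷_) xss))
    (cong₂ _+_ (length-map (suc j ∷_) xss) (length-prefixParts (suc j) xsss))

  length-compositions : ∀ n → length (compositions n) ≡ F n ℓ
  map-length-compositions∷Below : ∀ n → map length (compositions n ∷ compositionsBelow n) ≡ Fvals ℓ n

  length-compositions zero    = refl
  length-compositions (suc n) = trans (length-prefixParts 0 (take ℓ table))
    (cong sum (trans (sym (take-map ℓ table)) (cong (take ℓ) (map-length-compositions∷Below n))))
    where table = compositions n ∷ compositionsBelow n

  map-length-compositions∷Below zero    = refl
  map-length-compositions∷Below (suc n) =
    cong₂ _∷_ (length-compositions (suc n)) (map-length-compositions∷Below n)

  drop-compositions∷Below : ∀ i s →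
    drop i (compositions (i + s) ∷ compositionsBelow (i + s)) ≡ compositions s ∷ compositionsBelow s
  drop-compositions∷Below zero    s = refl
  drop-compositions∷Below (suc i) s = drop-compositions∷Below i s

  ∈-prefixParts : ∀ {ys xss rest} i j xsss m → drop i xsss ≡ xss ∷ rest → ys ∈ xss → i < m →
                  suc (j + i) ∷ ys ∈ prefixParts j (take m xsss)
  ∈-prefixParts zero j (xss ∷ xsss) (suc m) refl ys∈ _ rewrite +-identityʳ j =
    ∈-++⁺ˡ (∈-map⁺ (suc j ∷_) ys∈)
  ∈-prefixParts (suc i) j (xss ∷ xsss) (suc m) eq ys∈ (s≤s i<m) rewrite +-suc j i =
    ∈-++⁺ʳ (map (suc j ∷_) xss) (∈-prefixParts i (suc j) xsss m eq ys∈ i<m)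

  ∈-compositions : ∀ {xs} → All Part xs → xs ∈ compositions (sum xs)
  ∈-compositions []                             = here refl
  ∈-compositions {suc i ∷ ys} ((_ , i<ℓ) ∷ ps) =
    ∈-prefixParts i 0 _ ℓ (drop-compositions∷Below i (sum ys)) (∈-compositions ps) i<ℓ

data Shape : Set where
  complete endEdge firstStar lastStar path crossing nesting : Shape

-- Q1 and Q2 have order 4; at other orders their shapes are given the junk value K_m.
basic : Shape → (m : ℕ) → Graph m
basic complete  m = J1 m
basic endEdge   m = J2 m
basic firstStar m = J3 m
basic lastStar  m = J4 m
basic path      m = L m
basic crossing  4 = Q1
basic nesting   4 = Q2
basic _         m = J1 m

shapes : List Shape
shapes = complete ∷ endEdge ∷ firstStar ∷ lastStar ∷ path ∷ crossing ∷ nesting ∷ []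

∈-shapes : ∀ s → s ∈ shapes
∈-shapes complete  = here refl
∈-shapes endEdge   = there (here refl)
∈-shapes firstStar = there (there (here refl))
∈-shapes lastStar  = there (there (there (here refl)))
∈-shapes path      = there (there (there (there (here refl))))
∈-shapes crossing  = there (there (there (there (there (here refl)))))
∈-shapes nesting   = there (there (there (there (there (there (here refl))))))

module _ {ℓ : ℕ} where

  InJℓ-order : ∀ {m A} → InJℓ ℓ (m , A) → 1 ≤ m × m ≤ ℓ
  InJℓ-order (j1 1≤m m≤ℓ) = 1≤m , m≤ℓ
  InJℓ-order (j2 1≤m m≤ℓ) = 1≤m , m≤ℓ
  InJℓ-order (j3 1≤m m≤ℓ) = 1≤m , m≤ℓ
  InJℓ-order (j4 1≤m m≤ℓ) = 1≤m , m≤ℓ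
  InJℓ-order (jL 1≤m m≤ℓ) = 1≤m , m≤ℓ
  InJℓ-order (q1 4≤ℓ)     = s≤s z≤n , 4≤ℓ
  InJℓ-order (q2 4≤ℓ)     = s≤s z≤n , 4≤ℓ

  InJℓ-basic : ∀ {m A} → InJℓ ℓ (m , A) → ∃ λ s → basic s m ≡ A
  InJℓ-basic (j1 _ _) = complete  , refl
  InJℓ-basic (j2 _ _) = endEdge   , refl
  InJℓ-basic (j3 _ _) = firstStar , refl
  InJℓ-basic (j4 _ _) = lastStar  , refl
  InJℓ-basic (jL _ _) = path      , refl
  InJℓ-basic (q1 _)   = crossing  , refl
  InJℓ-basic (q2 _)   = nesting   , refl

_≟ᴳ_ : DecidableEquality OGraph
_≟ᴳ_ = Product.≡-dec _≟_ (Vecₚ.≡-dec (Vecₚ.≡-dec Bool._≟_))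

open import Data.List.Membership.DecPropositional _≟ᴳ_ using (_∈?_)

shapeOfOrder : List OGraph → ℕ → Shape
shapeOfOrder Bs m with any? (λ s → (m , basic s m) ∈? Bs) shapes
... | yes found = proj₁ (find found)
... | no  _     = complete

shapeOfOrder-∈ : ∀ {Bs m} s → (m , basic s m) ∈ Bs → (m , basic (shapeOfOrder Bs m) m) ∈ Bs
shapeOfOrder-∈ {Bs} {m} s s∈ with any? (λ s → (m , basic s m) ∈? Bs) shapes
... | yes found = proj₂ (proj₂ (find found))
... | no  none  = contradiction (lose (∈-shapes s) s∈) none

Profile : Set
Profile = List Shape

shapeAt : Profile → ℕ → Shape
shapeAt []      _       = complete
shapeAt (s ∷ _) zero    = s
shapeAt (_ ∷ p) (suc m) = shapeAt p m

shapeAt-applyUpTo : ∀ f {n m} → m < n → shapeAt (applyUpTo f n) m ≡ f m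
shapeAt-applyUpTo f {suc n} {zero}  _         = refl
shapeAt-applyUpTo f {suc n} {suc m} (s≤s m<n) = shapeAt-applyUpTo (f ∘ suc) m<n

piece : Profile → ℕ → OGraph
piece p m = m , basic (shapeAt p m) m

orders : List OGraph → List ℕ
orders = map proj₁

sum-concatMap-orders : ∀ Bss → sum (concatMap orders Bss) ≡ proj₁ (⨁ (map ⨁ Bss))
sum-concatMap-orders []         = refl
sum-concatMap-orders (Bs ∷ Bss) = trans (sum-++ (orders Bs) (concatMap orders Bss))
  (cong₂ _+_ (sym (order-⨁ Bs)) (sum-concatMap-orders Bss))

take-length-++ : ∀ {A : Set} (xs ys : List A) → take (length xs) (xs ++ ys) ≡ xs
take-length-++ []       ys = refl
take-length-++ (x ∷ xs) ys = cong (x ∷_) (take-length-++ xs ys)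

drop-length-++ : ∀ {A : Set} (xs ys : List A) → drop (length xs) (xs ++ ys) ≡ ys
drop-length-++ []       ys = refl
drop-length-++ (x ∷ xs) ys = drop-length-++ xs ys

-- A code lists the orders of all pieces, then the profile and number of pieces of every block
-- but the last, then the profile of the last block.
Cut : Set
Cut = Profile × ℕ

Code : Set
Code = List ℕ × List Cut × Profile

blocksOf : List Cut → Profile → List ℕ → List (List OGraph)
blocksOf []              p  ms = map (piece p) ms ∷ []
blocksOf ((p , c) ∷ cuts) p′ ms = map (piece p) (take c ms) ∷ blocksOf cuts p′ (drop c ms)

decode : Code → OGraph
decode (ms , cuts , p) = ⨁ (map ⨁ (blocksOf cuts p ms))

module Encoding (ℓ : ℕ) where
  open Compositions ℓ

  profileOf : List OGraph → Profile
  profileOf Bs = applyUpTo (shapeOfOrder Bs) (suc ℓ)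

  piece-profileOf : ∀ {Bs} → ValidBlock ℓ Bs → ∀ {B} → B ∈ Bs → piece (profileOf Bs) (proj₁ B) ≡ B
  piece-profileOf {Bs} (inJ , comparable) {m , A} B∈ with InJℓ-basic (inJ B∈)
  ... | s , refl = cong (m ,_) (begin
    basic (shapeAt (profileOf Bs) m) m  ≡⟨ cong (λ s → basic s m) (shapeAt-applyUpTo (shapeOfOrder Bs) m<1+ℓ) ⟩
    basic (shapeOfOrder Bs m) m         ≡⟨ comparable-sameOrder⇒≡ (comparable chosen∈ B∈) ⟩
    basic s m                           ∎)
    where
    open ≡-Reasoning
    m<1+ℓ = s≤s (proj₂ (InJℓ-order (inJ B∈)))
    chosen∈ = shapeOfOrder-∈ s B∈

  pieces-profileOf : ∀ {Bs} → ValidBlock ℓ Bs → map (piece (profileOf Bs)) (orders Bs) ≡ Bs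
  pieces-profileOf {Bs} v = trans (sym (map-∘ Bs)) (map-id-local (All.tabulate (piece-profileOf v)))

  orders-parts : ∀ {Bs} → ValidBlock ℓ Bs → All Part (orders Bs)
  orders-parts (inJ , _) = Allₚ.map⁺ (All.tabulate (InJℓ-order ∘ inJ))

  cutsOf : List OGraph → List (List OGraph) → List Cut
  cutsOf Bs []          = []
  cutsOf Bs (Bs′ ∷ Bss) = (profileOf Bs , length (orders Bs)) ∷ cutsOf Bs′ Bss

  lastProfileOf : List OGraph → List (List OGraph) → Profile
  lastProfileOf Bs []          = profileOf Bs
  lastProfileOf _  (Bs′ ∷ Bss) = lastProfileOf Bs′ Bss

  encode : List OGraph → List (List OGraph) → Code
  encode Bs Bss = concatMap orders (Bs ∷ Bss) , cutsOf Bs Bss , lastProfileOf Bs Bss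

  blocksOf-encode : ∀ {Bs Bss} → All (ValidBlock ℓ) (Bs ∷ Bss) →
    blocksOf (cutsOf Bs Bss) (lastProfileOf Bs Bss) (concatMap orders (Bs ∷ Bss)) ≡ Bs ∷ Bss
  blocksOf-encode {Bs} {[]} (v ∷ []) =
    cong (_∷ []) (trans (cong (map _) (++-identityʳ (orders Bs))) (pieces-profileOf v))
  blocksOf-encode {Bs} {Bs′ ∷ Bss} (v ∷ vs) = cong₂ _∷_
    (trans (cong (map _) (take-length-++ (orders Bs) _)) (pieces-profileOf v))
    (trans (cong (blocksOf _ _) (drop-length-++ (orders Bs) _)) (blocksOf-encode vs))

  profiles : List Profile
  profiles = lists≤ shapes (suc ℓ)

  profileOf-∈ : ∀ Bs → profileOf Bs ∈ profiles
  profileOf-∈ Bs = ∈-lists≤ (All.tabulate λ {s} _ → ∈-shapes s)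
                             (≤-reflexive (length-applyUpTo (shapeOfOrder Bs) (suc ℓ)))

  lastProfileOf-∈ : ∀ Bs Bss → lastProfileOf Bs Bss ∈ profiles
  lastProfileOf-∈ Bs []          = profileOf-∈ Bs
  lastProfileOf-∈ _  (Bs′ ∷ Bss) = lastProfileOf-∈ Bs′ Bss

  cutAlphabet : ℕ → List Cut
  cutAlphabet n = cartesianProduct profiles (upTo (suc n))

  cutsOf-∈ : ∀ {Bs Bss n} → All (ValidBlock ℓ) (Bs ∷ Bss) → sum (concatMap orders (Bs ∷ Bss)) ≤ n →
             All (_∈ cutAlphabet n) (cutsOf Bs Bss)
  cutsOf-∈ {Bs} {[]}       _        _     = []
  cutsOf-∈ {Bs} {Bs′ ∷ Bss} (v ∷ vs) total =
    ∈-cartesianProduct⁺ (profileOf-∈ Bs) (∈-upTo⁺ (s≤s pieces≤n)) ∷ cutsOf-∈ vs rest≤n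
    where
    split = subst (_≤ _) (sum-++ (orders Bs) (concatMap orders (Bs′ ∷ Bss))) total
    pieces≤n = ≤-trans (length≤sum (All.map proj₁ (orders-parts v))) (m+n≤o⇒m≤o _ split)
    rest≤n = m+n≤o⇒n≤o (sum (orders Bs)) split

  length-cutsOf : ∀ Bs Bss → length (cutsOf Bs Bss) ≡ length Bss
  length-cutsOf Bs []          = refl
  length-cutsOf Bs (Bs′ ∷ Bss) = cong suc (length-cutsOf Bs′ Bss)

  codes : ℕ → ℕ → List Code
  codes j n = cartesianProduct (compositions n)
                (cartesianProduct (lists≤ (cutAlphabet n) j) profiles)

  encode-∈-codes : ∀ {Bs Bss j n} → All (ValidBlock ℓ) (Bs ∷ Bss) → length (Bs ∷ Bss) ≤ suc j →
                   sum (concatMap orders (Bs ∷ Bss)) ≡ n → encode Bs Bss ∈ codes j n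
  encode-∈-codes {Bs} {Bss} {j} vs (s≤s blocks≤) refl = ∈-cartesianProduct⁺
    (∈-compositions (Allₚ.concat⁺ (Allₚ.map⁺ (All.map orders-parts vs))))
    (∈-cartesianProduct⁺
      (∈-lists≤ (cutsOf-∈ vs ≤-refl) (subst (_≤ j) (sym (length-cutsOf Bs Bss)) blocks≤))
      (lastProfileOf-∈ Bs Bss))

  InJ-∈-decode : ∀ {j n G} → 1 ≤ n → InJ (suc j) ℓ (n , G) → (n , G) ∈ map decode (codes j n)
  InJ-∈-decode 1≤n ([] , _ , _ , eq) = contradiction (sym (cong proj₁ eq)) (>⇒≢ 1≤n)
  InJ-∈-decode {j} {n} _ (Bs ∷ Bss , blocks≤ , valid , eq) =
    subst (_∈ map decode (codes j n)) (trans (cong (⨁ ∘ map ⨁) (blocksOf-encode vs)) eq)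
      (∈-map⁺ decode (encode-∈-codes vs blocks≤
        (trans (sum-concatMap-orders (Bs ∷ Bss)) (cong proj₁ eq))))
    where vs = All.tabulate valid

  length-InJ≤length-codes : ∀ {j n} {Gs : List (Graph n)} → 1 ≤ n → Unique Gs →
    All (λ G → InJ (suc j) ℓ (n , G)) Gs → length Gs ≤ length (codes j n)
  length-InJ≤length-codes {j} {n} {Gs} 1≤n u inJ = begin
    length Gs                        ≡⟨ length-map withOrder Gs ⟨
    length (map withOrder Gs)        ≤⟨ Unique⇒length≤ (Unique.map⁺ withOrder-injective u) ⊆codes ⟩
    length (map decode (codes j n))  ≡⟨ length-map decode (codes j n) ⟩
    length (codes j n)               ∎
    where
    open ≤-Reasoning
    withOrder : Graph n → OGraph
    withOrder = n ,_

    withOrder-injective : ∀ {G H} → withOrder G ≡ withOrder H → G ≡ H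
    withOrder-injective = Product.,-injectiveʳ-UIP ≡-irrelevant

    ⊆codes : map withOrder Gs ⊆ map decode (codes j n)
    ⊆codes G∈ with G , G∈Gs , refl ← ∈-map⁻ withOrder G∈ = InJ-∈-decode 1≤n (All.lookup inJ G∈Gs)

  length-codes≤ : ∀ j n →
    length (codes j n) ≤ F n ℓ * (suc (length profiles * suc n) ^ j * length profiles)
  length-codes≤ j n = begin
    length (codes j n)
      ≡⟨ length-cartesianProductWith _,_ (compositions n) _ ⟩
    length (compositions n) * length (cartesianProduct (lists≤ (cutAlphabet n) j) profiles)
      ≡⟨ cong₂ _*_ (length-compositions n) (length-cartesianProductWith _,_ (lists≤ (cutAlphabet n) j) profiles) ⟩
    F n ℓ * (length (lists≤ (cutAlphabet n) j) * length profiles)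
      ≤⟨ *-monoʳ-≤ (F n ℓ) (*-monoˡ-≤ (length profiles) (length-lists≤ (cutAlphabet n) j)) ⟩
    F n ℓ * (suc (length (cutAlphabet n)) ^ j * length profiles)
      ≡⟨ cong (λ c → F n ℓ * (suc c ^ j * length profiles)) length-cutAlphabet ⟩
    F n ℓ * (suc (length profiles * suc n) ^ j * length profiles)  ∎
    where
    open ≤-Reasoning
    length-cutAlphabet : length (cutAlphabet n) ≡ length profiles * suc n
    length-cutAlphabet = trans (length-cartesianProductWith _,_ profiles (upTo (suc n)))
                               (cong (length profiles *_) (length-upTo (suc n)))

1+p[1+n]≤[1+2p]n : ∀ p {n} → 1 ≤ n → suc (p * suc n) ≤ (1 + 2 * p) * n
1+p[1+n]≤[1+2p]n p {suc m} _ = subst (suc (p * suc (suc m)) ≤_) (identity p m) (m≤m+n _ (m + p * m))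
  where
  identity : ∀ p m → suc (p * suc (suc m)) + (m + p * m) ≡ (1 + 2 * p) * suc m
  identity = solve-∀

lemma7p3 : (k ℓ : ℕ) →
    Σ ℕ λ C → Σ ℕ λ N → (n : ℕ) → N ≤ n → 1 ≤ n →
      (Gs : List (Graph n)) → Unique Gs → All (λ G → InJ k ℓ (n , G)) Gs →
      length Gs * n ≤ C * (n ^ k * F n ℓ)
lemma7p3 zero ℓ = 0 , 0 , λ where
  n _ 1≤n []      _ _         → z≤n
  n _ 1≤n (_ ∷ _) _ (inJ ∷ _) → contradiction (InJ-zero⇒order≡0 inJ) (>⇒≢ 1≤n)
lemma7p3 (suc j) ℓ = p * (1 + 2 * p) ^ j , 0 , λ n _ 1≤n Gs u inJ → begin
  length Gs * n
    ≤⟨ *-monoˡ-≤ n (≤-trans (length-InJ≤length-codes 1≤n u inJ) (length-codes≤ j n)) ⟩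
  F n ℓ * (suc (p * suc n) ^ j * p) * n
    ≤⟨ *-monoˡ-≤ n (*-monoʳ-≤ (F n ℓ) (*-monoˡ-≤ p (^-monoˡ-≤ j (1+p[1+n]≤[1+2p]n p 1≤n)))) ⟩
  F n ℓ * (((1 + 2 * p) * n) ^ j * p) * n
    ≡⟨ cong (λ x → F n ℓ * (x * p) * n) (^-distrib-* (1 + 2 * p) n j) ⟩
  F n ℓ * ((1 + 2 * p) ^ j * n ^ j * p) * n
    ≡⟨ rearrange (F n ℓ) ((1 + 2 * p) ^ j) (n ^ j) p n ⟩
  p * (1 + 2 * p) ^ j * (n ^ suc j * F n ℓ)  ∎
  where
  open Encoding ℓ
  open ≤-Reasoning
  p = length profiles
  rearrange : ∀ f a b p n → f * (a * b * p) * n ≡ p * a * (n * b * f)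
  rearrange = solve-∀
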